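{- If $G$ is a strong $\mathfrak{I}$-contractible graph, then $G$ is a collapsible graph, i.e. its clique complex $\Delta(G)$ collapses to a point.
   Context: Graphs are finite, undirected, without loops or multiple edges. For a vertex $v$ of $G$, $N_G(v)$ denotes the subgraph induced on the vertices adjacent to $v$; for vertices $v_1,v_2$, $N_G(v_1,v_2)$ is the subgraph induced on $N_G(v_1)\cap N_G(v_2)$. The family $\mathfrak{I}_S$ of strong $\mathfrak{I}$-contractible graphs is the smallest family of graphs containing the one-vertex graph $K(1)$ and closed under: (I2) gluing a vertex: if $G\in\mathfrak{I}_S$ and $G'$ is an induced subgraph of $G$ with $G'\in\mathfrak{I}_S$, then the graph obtained by adding a new vertex $v$ adjacent exactly to the vertices of $G'$ (so $N(v)=G'$) is in $\mathfrak{I}_S$; (I4) gluing an edge: if $G\in\mathfrak{I}_S$ and $v_1,v_2$ are nonadjacent vertices of $G$ with $N_G(v_1,v_2)\in\mathfrak{I}_S$, then $G$ with the edge $\{v_1,v_2\}$ added is in $\mathfrak{I}_S$. The clique complex $\Delta(G)$ is the abstract simplicial complex whose simplices are the vertex sets of complete subgraphs of $G$. In a simplicial complex $\Delta$, a pair $\sigma\subsetneq\tau$ is free if $\tau$ is a maximal face and no other maximal face contains $\sigma$; a collapse removes all $\gamma$ with $\sigma\subseteq\gamma\subseteq\tau$. $\Delta$ is collapsible if it can be reduced to a single vertex $\Delta^0$ by a finite sequence of collapses. A graph $G$ is collapsible if $\Delta(G)$ is collapsible. -}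

module Defs where

open import Data.Nat using (ℕ; suc)
open import Data.Fin using (Fin; zero; suc)
open import Data.Bool using (Bool; true; false)
open import Data.Vec using (lookup)
open import Data.Product using (∃; _×_; _,_)
open import Data.Sum using (_⊎_)
open import Data.Fin.Subset using (Subset; _∈_; _∉_; _⊆_; _⊂_; Nonempty; ⁅_⁆)
open import Relation.Binary.PropositionalEquality using (_≡_; _≢_)
open import Relation.Nullary using (¬_)
open import Relation.Unary using (Pred)
open import Function.Bundles using (_⇔_)

record Graph (n : ℕ) : Set where
  field
    adj    : Fin n → Fin n → Bool
    sym    : ∀ x y → adj x y ≡ adj y x
    irrefl : ∀ x → adj x x ≡ false
open Graph public

_~[_]_ : ∀ {n} → Fin n → Graph n → Fin n → Set
x ~[ G ] y = adj G x y ≡ true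

record _≅_ {m n} (G : Graph m) (H : Graph n) : Set where
  field
    to       : Fin m → Fin n
    from     : Fin n → Fin m
    to-from  : ∀ y → to (from y) ≡ y
    from-to  : ∀ x → from (to x) ≡ x
    preserve : ∀ x y → adj H (to x) (to y) ≡ adj G x y

-- H is (isomorphic to) the subgraph of G induced on the vertex set S:
-- an injective map preserving and reflecting adjacency whose image is exactly S.
record InducedOn {m n} (H : Graph m) (G : Graph n) (S : Subset n) : Set where
  field
    emb      : Fin m → Fin n
    inj      : ∀ x y → emb x ≡ emb y → x ≡ y
    preserve : ∀ x y → adj G (emb x) (emb y) ≡ adj H x y
    image    : ∀ v → (v ∈ S) ⇔ (∃ λ x → emb x ≡ v)

-- (I2) G' is obtained from G by adding a new vertex (index zero) whose
-- neighbourhood is exactly the vertex set S (old vertices x are suc x).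
record GluedVertex {n} (G : Graph n) (S : Subset n) (G' : Graph (suc n)) : Set where
  field
    old : ∀ x y → adj G' (suc x) (suc y) ≡ adj G x y
    new : ∀ x → adj G' zero (suc x) ≡ lookup S x

CommonNbhd : ∀ {n} → Graph n → Fin n → Fin n → Subset n → Set
CommonNbhd G v₁ v₂ S = ∀ w → (w ∈ S) ⇔ (v₁ ~[ G ] w × v₂ ~[ G ] w)

GluedEdge : ∀ {n} → Graph n → Fin n → Fin n → Graph n → Set
GluedEdge G v₁ v₂ G' =
  ∀ x y → x ~[ G' ] y ⇔ (x ~[ G ] y ⊎ ((x ≡ v₁ × y ≡ v₂) ⊎ (x ≡ v₂ × y ≡ v₁)))

data StrongContractible : ∀ {n} → Graph n → Set where
  K1   : (G : Graph 1) → StrongContractible G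
  iso  : ∀ {m n} {G : Graph m} {H : Graph n} →
         StrongContractible G → G ≅ H → StrongContractible H
  I2   : ∀ {n m} {G : Graph n} {H : Graph m} {S : Subset n} {G' : Graph (suc n)} →
         StrongContractible G → StrongContractible H → InducedOn H G S →
         GluedVertex G S G' → StrongContractible G'
  I4   : ∀ {n m} {G : Graph n} {H : Graph m} {v₁ v₂ : Fin n} {S : Subset n}
         {G' : Graph n} →
         StrongContractible G → v₁ ≢ v₂ → ¬ (v₁ ~[ G ] v₂) →
         CommonNbhd G v₁ v₂ S → StrongContractible H → InducedOn H G S →
         GluedEdge G v₁ v₂ G' → StrongContractible G'

-- Simplicial complexes on Fin n: a set of (nonempty) faces

Complex : ℕ → Set₁
Complex n = Pred (Subset n) _

Δ : ∀ {n} → Graph n → Complex n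
Δ G σ = Nonempty σ × (∀ x y → x ∈ σ → y ∈ σ → x ≢ y → x ~[ G ] y)

Maximal : ∀ {n} → Complex n → Subset n → Set
Maximal K τ = K τ × (∀ ρ → K ρ → τ ⊆ ρ → ρ ≡ τ)

FreePair : ∀ {n} → Complex n → Subset n → Subset n → Set
FreePair K σ τ = K σ × σ ⊂ τ × Maximal K τ ×
                 (∀ ρ → Maximal K ρ → σ ⊆ ρ → ρ ≡ τ)

collapse : ∀ {n} → Complex n → Subset n → Subset n → Complex n
collapse K σ τ γ = K γ × ¬ (σ ⊆ γ × γ ⊆ τ)

_≈_ : ∀ {n} → Complex n → Complex n → Set
K ≈ L = ∀ σ → K σ ⇔ L σ

data CollapsesTo {n} : Complex n → Complex n → Set₁ where
  done : ∀ {K L} → K ≈ L → CollapsesTo K L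
  step : ∀ {K L} σ τ → FreePair K σ τ →
         CollapsesTo (collapse K σ τ) L → CollapsesTo K L

point : ∀ {n} → Fin n → Complex n
point v σ = σ ≡ ⁅ v ⁆

CollapsibleComplex : ∀ {n} → Complex n → Set₁
CollapsibleComplex {n} K = ∃ λ (v : Fin n) → CollapsesTo K (point v)

CollapsibleGraph : ∀ {n} → Graph n → Set₁
CollapsibleGraph G = CollapsibleComplex (Δ G)

-- The proof is by induction on the derivation of strong 𝔍-contractibility.
-- Its heart is a cone lemma about simplicial complexes: let A be a face of K
-- whose star is a cone over a complex L, i.e. the faces of K containing A are
-- A itself and the joins ρ ∪ A with the faces ρ of L (all disjoint from A).
-- Then every collapse of L onto a vertex w lifts to a collapse of K onto the
-- deletion of A (the faces not containing A): a free pair σ ⊊ τ of L lifts to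
-- the free pair σ ∪ A ⊊ τ ∪ A of K, and the last step collapses A ⊊ {w} ∪ A.
--
-- For a clique A of a graph G this applies with L the clique complex of G on
-- the common neighbourhood S of A.  Collapse sequences transport along
-- injective vertex maps, so when S induces a collapsible graph H, the complex
-- Δ(G) on S is collapsible.  Gluing a vertex (A = the new vertex) and gluing
-- an edge (A = its two ends) both produce a graph G' whose clique complex minus
-- the star of A is Δ(G); hence Δ(G') collapses onto Δ(G), which collapses to a
-- point by induction.  Isomorphic graphs are handled by the same transport.

module Submission where

open import Defs
open import Data.Nat using (ℕ; suc)
open import Data.Fin using (Fin; zero; suc)
open import Data.Fin.Properties using (any?; suc-injective) renaming (_≟_ to _≟ᶠ_)
open import Data.Bool using (true; false)
open import Data.Bool.Properties using (⇔→≡)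
open import Data.Vec using (lookup; tabulate; _∷_; []; here; there)
open import Data.Vec.Properties using (lookup∘tabulate; []=⇒lookup; lookup⇒[]=)
open import Data.Product using (∃; _×_; _,_; proj₁; proj₂)
open import Data.Sum using (_⊎_; inj₁; inj₂)
open import Data.Empty using (⊥-elim)
open import Data.Fin.Subset using (Subset; _∈_; _∉_; _⊆_; _⊂_; Nonempty; ⁅_⁆; _∪_; _∩_; ∁; ⊤)
open import Data.Fin.Subset.Properties
  using (⊆-antisym; ⊆-refl; ⊆-reflexive; ⊆-trans; x∈⁅x⁆; x∈⁅y⁆⇒x≡y; x∈p∪q⁻; x∈p∪q⁺; q⊆p∪q;
         _∈?_; x∈p∩q⁺; x∈p∩q⁻; x∉p⇒x∈∁p; x∈∁p⇒x∉p; nonempty?; ∈⊤)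
open import Relation.Binary.PropositionalEquality
  using (_≡_; _≢_; refl; cong; subst; trans) renaming (sym to ≡-sym)
open import Relation.Nullary using (¬_; Dec; yes; no; does)
open import Relation.Nullary.Decidable using (dec-true; _×-dec_)
open import Function.Bundles using (_⇔_; mk⇔; Equivalence)
open Equivalence using () renaming (to to ⇒; from to ⇐)

≈-sym : ∀ {n} {K L : Complex n} → K ≈ L → L ≈ K
≈-sym K≈L σ = mk⇔ (⇐ (K≈L σ)) (⇒ (K≈L σ))

≈-trans : ∀ {n} {K L M : Complex n} → K ≈ L → L ≈ M → K ≈ M
≈-trans K≈L L≈M σ = mk⇔ (λ k → ⇒ (L≈M σ) (⇒ (K≈L σ) k)) (λ m → ⇐ (K≈L σ) (⇐ (L≈M σ) m))

maximal-resp : ∀ {n} {K L : Complex n} {τ} → K ≈ L → Maximal K τ → Maximal L τ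
maximal-resp K≈L (Kτ , max) = ⇒ (K≈L _) Kτ , λ ρ Lρ τ⊆ρ → max ρ (⇐ (K≈L ρ) Lρ) τ⊆ρ

free-resp : ∀ {n} {K L : Complex n} {σ τ} → K ≈ L → FreePair K σ τ → FreePair L σ τ
free-resp K≈L (Kσ , σ⊂τ , maxτ , unique) =
  ⇒ (K≈L _) Kσ , σ⊂τ , maximal-resp K≈L maxτ ,
  λ ρ maxρ σ⊆ρ → unique ρ (maximal-resp (≈-sym K≈L) maxρ) σ⊆ρ

collapse-resp : ∀ {n} {K L : Complex n} σ τ → K ≈ L → collapse K σ τ ≈ collapse L σ τ
collapse-resp σ τ K≈L γ = mk⇔ (λ (k , c) → ⇒ (K≈L γ) k , c) (λ (l , c) → ⇐ (K≈L γ) l , c)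

collapsesTo-respˡ : ∀ {n} {K K' L : Complex n} → K ≈ K' → CollapsesTo K L → CollapsesTo K' L
collapsesTo-respˡ K≈K' (done K≈L) = done (≈-trans (≈-sym K≈K') K≈L)
collapsesTo-respˡ K≈K' (step σ τ free rest) =
  step σ τ (free-resp K≈K' free) (collapsesTo-respˡ (collapse-resp σ τ K≈K') rest)

collapsesTo-respʳ : ∀ {n} {K L L' : Complex n} → CollapsesTo K L → L ≈ L' → CollapsesTo K L'
collapsesTo-respʳ (done K≈L) L≈L' = done (≈-trans K≈L L≈L')
collapsesTo-respʳ (step σ τ free rest) L≈L' = step σ τ free (collapsesTo-respʳ rest L≈L')

collapsesTo-trans : ∀ {n} {K L M : Complex n} → CollapsesTo K L → CollapsesTo L M → CollapsesTo K M
collapsesTo-trans (done K≈L) L↘M = collapsesTo-respˡ (≈-sym K≈L) L↘M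
collapsesTo-trans (step σ τ free rest) L↘M = step σ τ free (collapsesTo-trans rest L↘M)

comprehension : ∀ {n} {P : Fin n → Set} → (∀ v → Dec (P v)) → Subset n
comprehension P? = tabulate (λ v → does (P? v))

∈-comprehension : ∀ {n} {P : Fin n → Set} (P? : ∀ v → Dec (P v)) {v : Fin n} →
                  v ∈ comprehension P? ⇔ P v
∈-comprehension P? {v} = mk⇔
  (λ v∈ → witness (P? v) (trans (≡-sym (lookup∘tabulate (λ u → does (P? u)) v)) ([]=⇒lookup v∈)))
  (λ Pv → lookup⇒[]= v (comprehension P?)
            (trans (lookup∘tabulate (λ u → does (P? u)) v) (dec-true (P? v) Pv)))
  where
    witness : ∀ {A : Set} (A? : Dec A) → does A? ≡ true → A
    witness (yes a) _ = a
    witness (no _) ()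

Disjoint : ∀ {n} → Subset n → Subset n → Set
Disjoint ρ A = ∀ {x} → x ∈ ρ → x ∉ A

∪-monoˡ-⊆ : ∀ {n} {σ ρ : Subset n} (A : Subset n) → σ ⊆ ρ → σ ∪ A ⊆ ρ ∪ A
∪-monoˡ-⊆ {σ = σ} A σ⊆ρ x∈ with x∈p∪q⁻ σ A x∈
... | inj₁ x∈σ = x∈p∪q⁺ (inj₁ (σ⊆ρ x∈σ))
... | inj₂ x∈A = x∈p∪q⁺ (inj₂ x∈A)

∪-cancelʳ-⊆ : ∀ {n} {σ ρ A : Subset n} → Disjoint σ A → σ ∪ A ⊆ ρ ∪ A → σ ⊆ ρ
∪-cancelʳ-⊆ {ρ = ρ} {A} σ#A σA⊆ρA x∈σ with x∈p∪q⁻ ρ A (σA⊆ρA (x∈p∪q⁺ (inj₁ x∈σ)))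
... | inj₁ x∈ρ = x∈ρ
... | inj₂ x∈A = ⊥-elim (σ#A x∈σ x∈A)

∪-cancelʳ : ∀ {n} {σ ρ A : Subset n} → Disjoint σ A → Disjoint ρ A → σ ∪ A ≡ ρ ∪ A → σ ≡ ρ
∪-cancelʳ σ#A ρ#A eq =
  ⊆-antisym (∪-cancelʳ-⊆ σ#A (⊆-reflexive eq)) (∪-cancelʳ-⊆ ρ#A (⊆-reflexive (≡-sym eq)))

∪-⊈ : ∀ {n} {σ A : Subset n} → Nonempty σ → Disjoint σ A → ¬ (σ ∪ A ⊆ A)
∪-⊈ (x , x∈σ) σ#A σA⊆A = σ#A x∈σ (σA⊆A (x∈p∪q⁺ (inj₁ x∈σ)))

-- Images of free pairs are free pairs and images commute with collapses, so
-- a collapse sequence of K is carried to one of f[K].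

module Image {m n} (f : Fin m → Fin n) (f-inj : ∀ x y → f x ≡ f y → x ≡ y) where

  in-image? : (σ : Subset m) (v : Fin n) → Dec (∃ λ x → x ∈ σ × f x ≡ v)
  in-image? σ v = any? (λ x → (x ∈? σ) ×-dec (f x ≟ᶠ v))

  img : Subset m → Subset n
  img σ = comprehension (in-image? σ)

  img-out : ∀ {σ v} → v ∈ img σ → ∃ λ x → x ∈ σ × f x ≡ v
  img-out {σ} = ⇒ (∈-comprehension (in-image? σ))

  img-in : ∀ {σ x} → x ∈ σ → f x ∈ img σ
  img-in {σ} x∈σ = ⇐ (∈-comprehension (in-image? σ)) (_ , x∈σ , refl)

  img-mono : ∀ {σ τ} → σ ⊆ τ → img σ ⊆ img τ
  img-mono σ⊆τ v∈ with img-out v∈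
  ... | x , x∈σ , refl = img-in (σ⊆τ x∈σ)

  -- the only place where injectivity is needed
  img-reflects-∈ : ∀ {σ x} → f x ∈ img σ → x ∈ σ
  img-reflects-∈ {σ} {x} fx∈ with img-out fx∈
  ... | y , y∈σ , fy≡fx = subst (_∈ σ) (f-inj y x fy≡fx) y∈σ

  img-reflects-⊆ : ∀ {σ τ} → img σ ⊆ img τ → σ ⊆ τ
  img-reflects-⊆ fσ⊆fτ x∈σ = img-reflects-∈ (fσ⊆fτ (img-in x∈σ))

  img-injective : ∀ {σ τ} → img σ ≡ img τ → σ ≡ τ
  img-injective eq =
    ⊆-antisym (img-reflects-⊆ (⊆-reflexive eq)) (img-reflects-⊆ (⊆-reflexive (≡-sym eq)))

  img-⊂ : ∀ {σ τ} → σ ⊂ τ → img σ ⊂ img τ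
  img-⊂ (σ⊆τ , x , x∈τ , x∉σ) = img-mono σ⊆τ , f x , img-in x∈τ , λ fx∈ → x∉σ (img-reflects-∈ fx∈)

  img-⁅⁆ : ∀ w → img ⁅ w ⁆ ≡ ⁅ f w ⁆
  img-⁅⁆ w = ⊆-antisym into from
    where
      from : ⁅ f w ⁆ ⊆ img ⁅ w ⁆
      from v∈ rewrite x∈⁅y⁆⇒x≡y (f w) v∈ = img-in (x∈⁅x⁆ w)
      into : img ⁅ w ⁆ ⊆ ⁅ f w ⁆
      into v∈ with img-out v∈
      ... | x , x∈⁅w⁆ , refl rewrite x∈⁅y⁆⇒x≡y w x∈⁅w⁆ = x∈⁅x⁆ (f w)

  push : Complex m → Complex n
  push K γ = ∃ λ σ → γ ≡ img σ × K σ

  push-≈ : ∀ {K L} → K ≈ L → push K ≈ push L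
  push-≈ K≈L γ = mk⇔ (λ (σ , eq , k) → σ , eq , ⇒ (K≈L σ) k) (λ (σ , eq , l) → σ , eq , ⇐ (K≈L σ) l)

  push-maximal : ∀ {K τ} → Maximal K τ → Maximal (push K) (img τ)
  push-maximal {K} {τ} (Kτ , max) = (τ , refl , Kτ) , maximal
    where
      maximal : ∀ ρ → push K ρ → img τ ⊆ ρ → ρ ≡ img τ
      maximal ρ (ρ' , refl , Kρ') fτ⊆fρ' = cong img (max ρ' Kρ' (img-reflects-⊆ fτ⊆fρ'))

  push-maximal⁻ : ∀ {K τ} → Maximal (push K) (img τ) → K τ → Maximal K τ
  push-maximal⁻ (_ , max) Kτ =
    Kτ , λ ρ Kρ τ⊆ρ → img-injective (max (img ρ) (ρ , refl , Kρ) (img-mono τ⊆ρ))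

  push-free : ∀ {K σ τ} → FreePair K σ τ → FreePair (push K) (img σ) (img τ)
  push-free {K} {σ} {τ} (Kσ , σ⊂τ , maxτ , unique) = (σ , refl , Kσ) , img-⊂ σ⊂τ , push-maximal maxτ , unique'
    where
      unique' : ∀ ρ → Maximal (push K) ρ → img σ ⊆ ρ → ρ ≡ img τ
      unique' ρ maxρ@((ρ' , refl , Kρ') , _) fσ⊆fρ' =
        cong img (unique ρ' (push-maximal⁻ maxρ Kρ') (img-reflects-⊆ fσ⊆fρ'))

  push-collapse : ∀ {K} σ τ → collapse (push K) (img σ) (img τ) ≈ push (collapse K σ τ)
  push-collapse σ τ γ = mk⇔
    (λ { ((σ' , refl , k) , c) → σ' , refl , k , λ (a , b) → c (img-mono a , img-mono b) })
    (λ { (σ' , refl , k , c) → (σ' , refl , k) , λ (a , b) → c (img-reflects-⊆ a , img-reflects-⊆ b) })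

  push-collapsesTo : ∀ {K L} → CollapsesTo K L → CollapsesTo (push K) (push L)
  push-collapsesTo (done K≈L) = done (push-≈ K≈L)
  push-collapsesTo (step σ τ free rest) =
    step (img σ) (img τ) (push-free free)
         (collapsesTo-respˡ (≈-sym (push-collapse σ τ)) (push-collapsesTo rest))

  push-point : ∀ w → push (point w) ≈ point (f w)
  push-point w γ = mk⇔ (λ { (σ , refl , refl) → img-⁅⁆ w })
                       (λ γ≡ → ⁅ w ⁆ , trans γ≡ (≡-sym (img-⁅⁆ w)) , refl)

module Cone {n} (A : Subset n) where

  record IsLink (L K : Complex n) : Set₁ where
    field
      nonempty : ∀ {ρ} → L ρ → Nonempty ρ
      disjoint : ∀ {ρ} → L ρ → Disjoint ρ A
      star     : ∀ γ → A ⊆ γ → K γ ⇔ (γ ≡ A ⊎ ∃ λ ρ → L ρ × γ ≡ ρ ∪ A)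

  deletion : Complex n → Complex n
  deletion K γ = K γ × ¬ (A ⊆ γ)

  module _ {L K : Complex n} (link : IsLink L K) where
    open IsLink link

    join-face : ∀ {ρ} → L ρ → K (ρ ∪ A)
    join-face Lρ = ⇐ (star _ (q⊆p∪q _ A)) (inj₂ (_ , Lρ , refl))

    above-join : ∀ {σ γ} → L σ → K γ → σ ∪ A ⊆ γ → ∃ λ ρ → L ρ × γ ≡ ρ ∪ A
    above-join Lσ Kγ σA⊆γ with ⇒ (star _ (⊆-trans (q⊆p∪q _ A) σA⊆γ)) Kγ
    ... | inj₁ refl = ⊥-elim (∪-⊈ (nonempty Lσ) (disjoint Lσ) σA⊆γ)
    ... | inj₂ join = join

    join-maximal : ∀ {τ} → Maximal L τ → Maximal K (τ ∪ A)
    join-maximal {τ} (Lτ , max) = join-face Lτ , maximal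
      where
        maximal : ∀ ρ → K ρ → τ ∪ A ⊆ ρ → ρ ≡ τ ∪ A
        maximal ρ Kρ τA⊆ρ with above-join Lτ Kρ τA⊆ρ
        ... | ρ' , Lρ' , refl = cong (_∪ A) (max ρ' Lρ' (∪-cancelʳ-⊆ (disjoint Lτ) τA⊆ρ))

    join-maximal⁻ : ∀ {τ} → Maximal K (τ ∪ A) → L τ → Maximal L τ
    join-maximal⁻ (_ , max) Lτ = Lτ , λ ρ Lρ τ⊆ρ →
      ∪-cancelʳ (disjoint Lρ) (disjoint Lτ) (max (ρ ∪ A) (join-face Lρ) (∪-monoˡ-⊆ A τ⊆ρ))

    join-free : ∀ {σ τ} → FreePair L σ τ → FreePair K (σ ∪ A) (τ ∪ A)
    join-free {σ} {τ} (Lσ , (σ⊆τ , x , x∈τ , x∉σ) , maxτ , unique) =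
      join-face Lσ , (∪-monoˡ-⊆ A σ⊆τ , x , x∈p∪q⁺ (inj₁ x∈τ) , x∉σA) , join-maximal maxτ , unique'
      where
        x∉σA : x ∉ σ ∪ A
        x∉σA x∈ with x∈p∪q⁻ σ A x∈
        ... | inj₁ x∈σ = x∉σ x∈σ
        ... | inj₂ x∈A = disjoint (proj₁ maxτ) x∈τ x∈A
        unique' : ∀ ρ → Maximal K ρ → σ ∪ A ⊆ ρ → ρ ≡ τ ∪ A
        unique' ρ maxρ σA⊆ρ with above-join Lσ (proj₁ maxρ) σA⊆ρ
        ... | ρ' , Lρ' , refl =
          cong (_∪ A) (unique ρ' (join-maximal⁻ maxρ Lρ') (∪-cancelʳ-⊆ (disjoint Lσ) σA⊆ρ))

    join-collapse : ∀ {σ τ} → L σ → IsLink (collapse L σ τ) (collapse K (σ ∪ A) (τ ∪ A))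
    join-collapse {σ} {τ} Lσ = record
      { nonempty = λ L'ρ → nonempty (proj₁ L'ρ)
      ; disjoint = λ L'ρ → disjoint (proj₁ L'ρ)
      ; star     = λ γ A⊆γ → mk⇔ (into γ A⊆γ) (from γ A⊆γ)
      }
      where
        into : ∀ γ → A ⊆ γ → collapse K (σ ∪ A) (τ ∪ A) γ →
               γ ≡ A ⊎ ∃ λ ρ → collapse L σ τ ρ × γ ≡ ρ ∪ A
        into γ A⊆γ (Kγ , kept) with ⇒ (star γ A⊆γ) Kγ
        ... | inj₁ γ≡A = inj₁ γ≡A
        ... | inj₂ (ρ , Lρ , refl) =
          inj₂ (ρ , (Lρ , λ (σ⊆ρ , ρ⊆τ) → kept (∪-monoˡ-⊆ A σ⊆ρ , ∪-monoˡ-⊆ A ρ⊆τ)) , refl)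
        from : ∀ γ → A ⊆ γ → (γ ≡ A ⊎ ∃ λ ρ → collapse L σ τ ρ × γ ≡ ρ ∪ A) →
               collapse K (σ ∪ A) (τ ∪ A) γ
        from γ A⊆γ (inj₁ refl) =
          ⇐ (star γ A⊆γ) (inj₁ refl) , λ (σA⊆A , _) → ∪-⊈ (nonempty Lσ) (disjoint Lσ) σA⊆A
        from γ A⊆γ (inj₂ (ρ , (Lρ , kept) , refl)) =
          join-face Lρ ,
          λ (σA⊆ρA , ρA⊆τA) → kept (∪-cancelʳ-⊆ (disjoint Lσ) σA⊆ρA , ∪-cancelʳ-⊆ (disjoint Lρ) ρA⊆τA)

    join-collapse-deletion : ∀ {σ τ} → deletion (collapse K (σ ∪ A) (τ ∪ A)) ≈ deletion K
    join-collapse-deletion {σ} γ = mk⇔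
      (λ ((Kγ , _) , A⊈γ) → Kγ , A⊈γ)
      (λ (Kγ , A⊈γ) → (Kγ , λ (σA⊆γ , _) → A⊈γ (⊆-trans (q⊆p∪q σ A) σA⊆γ)) , A⊈γ)

    apex-free : ∀ {w} → L ≈ point w → FreePair K A (⁅ w ⁆ ∪ A)
    apex-free {w} L≈w = KA , (q⊆p∪q _ A , w , w∈wA , w∉A) , maxw , unique
      where
        Lw : L ⁅ w ⁆
        Lw = ⇐ (L≈w ⁅ w ⁆) refl
        w∈wA : w ∈ ⁅ w ⁆ ∪ A
        w∈wA = x∈p∪q⁺ (inj₁ (x∈⁅x⁆ w))
        w∉A : w ∉ A
        w∉A = disjoint Lw (x∈⁅x⁆ w)
        KA : K A
        KA = ⇐ (star A ⊆-refl) (inj₁ refl)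
        maxw : Maximal K (⁅ w ⁆ ∪ A)
        maxw = join-maximal (Lw , λ ρ Lρ _ → ⇒ (L≈w ρ) Lρ)
        unique : ∀ ρ → Maximal K ρ → A ⊆ ρ → ρ ≡ ⁅ w ⁆ ∪ A
        unique ρ (Kρ , max) A⊆ρ with ⇒ (star ρ A⊆ρ) Kρ
        ... | inj₁ refl = ⊥-elim (w∉A (⊆-reflexive (max _ (proj₁ maxw) (q⊆p∪q _ A)) w∈wA))
        ... | inj₂ (ρ' , Lρ' , refl) = cong (_∪ A) (⇒ (L≈w ρ') Lρ')

    apex-collapse : ∀ {w} → L ≈ point w → collapse K A (⁅ w ⁆ ∪ A) ≈ deletion K
    apex-collapse {w} L≈w γ = mk⇔
      (λ (Kγ , kept) → Kγ , λ A⊆γ → kept (A⊆γ , below Kγ A⊆γ))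
      (λ (Kγ , A⊈γ) → Kγ , λ (A⊆γ , _) → A⊈γ A⊆γ)
      where
        below : K γ → A ⊆ γ → γ ⊆ ⁅ w ⁆ ∪ A
        below Kγ A⊆γ with ⇒ (star γ A⊆γ) Kγ
        ... | inj₁ refl = q⊆p∪q _ A
        ... | inj₂ (ρ , Lρ , refl) = ⊆-reflexive (cong (_∪ A) (⇒ (L≈w ρ) Lρ))

  cone : ∀ {L K : Complex n} {w} → IsLink L K → CollapsesTo L (point w) → CollapsesTo K (deletion K)
  cone link (done L≈w) = step A _ (apex-free link L≈w) (done (apex-collapse link L≈w))
  cone link (step σ τ free rest) =
    step (σ ∪ A) (τ ∪ A) (join-free link free)
         (collapsesTo-respʳ (cone (join-collapse link (proj₁ free)) rest) (join-collapse-deletion link))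

Clique : ∀ {n} → Graph n → Subset n → Set
Clique G σ = ∀ x y → x ∈ σ → y ∈ σ → x ≢ y → x ~[ G ] y

~-sym : ∀ {n} (G : Graph n) {x y} → x ~[ G ] y → y ~[ G ] x
~-sym G {x} {y} x~y = trans (sym G y x) x~y

~-irrefl : ∀ {n} (G : Graph n) {x} → ¬ (x ~[ G ] x)
~-irrefl G {x} x~x with trans (≡-sym x~x) (irrefl G x)
... | ()

ΔOn : ∀ {n} → Graph n → Subset n → Complex n
ΔOn G S ρ = Δ G ρ × ρ ⊆ S

IsCommonNbhd : ∀ {n} → Graph n → Subset n → Subset n → Set
IsCommonNbhd G A S = ∀ w → w ∈ S ⇔ (w ∉ A × ∀ {a} → a ∈ A → a ~[ G ] w)

module CliqueLink {n} (G : Graph n) {A S : Subset n}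
                  (A≠∅ : Nonempty A) (A-clique : Clique G A) (S-nbhd : IsCommonNbhd G A S) where

  split : ∀ {γ} → Δ G γ → A ⊆ γ → γ ≡ A ⊎ ∃ λ ρ → ΔOn G S ρ × γ ≡ ρ ∪ A
  split {γ} (_ , γ-clique) A⊆γ with nonempty? (γ ∩ ∁ A)
  ... | no  outside≡∅ = inj₁ (⊆-antisym γ⊆A A⊆γ)
    where
      γ⊆A : γ ⊆ A
      γ⊆A {x} x∈γ with x ∈? A
      ... | yes x∈A = x∈A
      ... | no  x∉A = ⊥-elim (outside≡∅ (x , x∈p∩q⁺ (x∈γ , x∉p⇒x∈∁p x∉A)))
  ... | yes outside≠∅ = inj₂ (γ ∩ ∁ A , ((outside≠∅ , clique) , ⊆S) , ⊆-antisym into from)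
    where
      outside : ∀ {x} → x ∈ γ ∩ ∁ A → x ∈ γ × x ∉ A
      outside {x} x∈ with x∈p∩q⁻ γ (∁ A) x∈
      ... | x∈γ , x∈∁A = x∈γ , x∈∁p⇒x∉p x∈∁A
      clique : Clique G (γ ∩ ∁ A)
      clique x y x∈ y∈ = γ-clique x y (proj₁ (outside x∈)) (proj₁ (outside y∈))
      ⊆S : γ ∩ ∁ A ⊆ S
      ⊆S {x} x∈ with outside x∈
      ... | x∈γ , x∉A = ⇐ (S-nbhd x) (x∉A , λ {a} a∈A →
                          γ-clique a x (A⊆γ a∈A) x∈γ (λ { refl → x∉A a∈A }))
      into : γ ⊆ (γ ∩ ∁ A) ∪ A
      into {x} x∈γ with x ∈? A
      ... | yes x∈A = x∈p∪q⁺ (inj₂ x∈A)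
      ... | no  x∉A = x∈p∪q⁺ (inj₁ (x∈p∩q⁺ (x∈γ , x∉p⇒x∈∁p x∉A)))
      from : (γ ∩ ∁ A) ∪ A ⊆ γ
      from {x} x∈ with x∈p∪q⁻ (γ ∩ ∁ A) A x∈
      ... | inj₁ x∈outside = proj₁ (outside x∈outside)
      ... | inj₂ x∈A = A⊆γ x∈A

  join-clique : ∀ {ρ} → ΔOn G S ρ → Clique G (ρ ∪ A)
  join-clique {ρ} ((_ , ρ-clique) , ρ⊆S) x y x∈ y∈ x≢y with x∈p∪q⁻ ρ A x∈ | x∈p∪q⁻ ρ A y∈
  ... | inj₁ x∈ρ | inj₁ y∈ρ = ρ-clique x y x∈ρ y∈ρ x≢y
  ... | inj₁ x∈ρ | inj₂ y∈A = ~-sym G (proj₂ (⇒ (S-nbhd x) (ρ⊆S x∈ρ)) y∈A)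
  ... | inj₂ x∈A | inj₁ y∈ρ = proj₂ (⇒ (S-nbhd y) (ρ⊆S y∈ρ)) x∈A
  ... | inj₂ x∈A | inj₂ y∈A = A-clique x y x∈A y∈A x≢y

  clique-link : Cone.IsLink A (ΔOn G S) (Δ G)
  clique-link = record
    { nonempty = λ Sρ → proj₁ (proj₁ Sρ)
    ; disjoint = λ Sρ x∈ρ → proj₁ (⇒ (S-nbhd _) (proj₂ Sρ x∈ρ))
    ; star     = λ γ A⊆γ → mk⇔ (λ Δγ → split Δγ A⊆γ) join
    }
    where
      join : ∀ {γ} → (γ ≡ A ⊎ ∃ λ ρ → ΔOn G S ρ × γ ≡ ρ ∪ A) → Δ G γ
      join (inj₁ refl) = A≠∅ , A-clique
      join (inj₂ (ρ , Sρ@(((x , x∈ρ) , _) , _) , refl)) = (x , x∈p∪q⁺ (inj₁ x∈ρ)) , join-clique Sρ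

  clique-cone : CollapsibleComplex (ΔOn G S) → CollapsesTo (Δ G) (Cone.deletion A (Δ G))
  clique-cone (_ , S↘w) = Cone.cone A clique-link S↘w

-- If H is induced on S in G, then Δ(G) on S is the image of Δ(H) under the
-- embedding; so Δ(G) on S is collapsible whenever H is.

module Induced {m n} {H : Graph m} {G : Graph n} {S : Subset n} (I : InducedOn H G S) where
  open InducedOn I
  open Image emb inj

  preimage : Subset n → Subset m
  preimage ρ = comprehension (λ y → emb y ∈? ρ)

  ∈-preimage : ∀ {ρ y} → y ∈ preimage ρ ⇔ emb y ∈ ρ
  ∈-preimage {ρ} = ∈-comprehension (λ y → emb y ∈? ρ)

  img-preimage : ∀ {ρ} → ρ ⊆ S → img (preimage ρ) ≡ ρ
  img-preimage {ρ} ρ⊆S = ⊆-antisym into from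
    where
      into : img (preimage ρ) ⊆ ρ
      into v∈ with img-out v∈
      ... | y , y∈ , refl = ⇒ ∈-preimage y∈
      from : ρ ⊆ img (preimage ρ)
      from v∈ρ with ⇒ (image _) (ρ⊆S v∈ρ)
      ... | y , refl = img-in (⇐ ∈-preimage v∈ρ)

  ΔOn≈push : ΔOn G S ≈ push (Δ H)
  ΔOn≈push ρ = mk⇔ into from
    where
      into : ΔOn G S ρ → push (Δ H) ρ
      into (((v , v∈ρ) , ρ-clique) , ρ⊆S) with ⇒ (image v) (ρ⊆S v∈ρ)
      ... | y , refl = preimage ρ , ≡-sym (img-preimage ρ⊆S) ,
                       (y , ⇐ ∈-preimage v∈ρ) , clique
        where
          clique : Clique H (preimage ρ)
          clique a b a∈ b∈ a≢b =
            trans (≡-sym (preserve a b))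
                  (ρ-clique (emb a) (emb b) (⇒ ∈-preimage a∈) (⇒ ∈-preimage b∈)
                            (λ eq → a≢b (inj a b eq)))
      from : push (Δ H) ρ → ΔOn G S ρ
      from (σ , refl , (x , x∈σ) , σ-clique) = ((emb x , img-in x∈σ) , clique) , ⊆S
        where
          clique : Clique G (img σ)
          clique u v u∈ v∈ u≢v with img-out u∈ | img-out v∈
          ... | a , a∈σ , refl | b , b∈σ , refl =
            trans (preserve a b) (σ-clique a b a∈σ b∈σ (λ { refl → u≢v refl }))
          ⊆S : img σ ⊆ S
          ⊆S v∈ with img-out v∈
          ... | a , _ , refl = ⇐ (image _) (a , refl)

  induced-collapsible : CollapsibleGraph H → CollapsibleComplex (ΔOn G S)
  induced-collapsible (w , H↘w) =
    emb w , collapsesTo-respˡ (≈-sym ΔOn≈push) (collapsesTo-respʳ (push-collapsesTo H↘w) (push-point w))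

K1-collapsible : (G : Graph 1) → CollapsibleGraph G
K1-collapsible G = zero , done Δ≈point
  where
    Δ≈point : Δ G ≈ point zero
    Δ≈point (true ∷ []) = mk⇔ (λ _ → refl) (λ _ → (zero , here) , clique)
      where
        clique : Clique G (true ∷ [])
        clique zero zero _ _ 0≢0 = ⊥-elim (0≢0 refl)
    Δ≈point (false ∷ []) = mk⇔ (λ { ((zero , ()) , _) }) (λ ())

iso-induced : ∀ {m n} {G : Graph m} {H : Graph n} → G ≅ H → InducedOn G H ⊤
iso-induced G≅H = record
  { emb      = to
  ; inj      = λ x y eq → trans (≡-sym (from-to x)) (trans (cong from eq) (from-to y))
  ; preserve = preserve
  ; image    = λ v → mk⇔ (λ _ → from v , to-from v) (λ _ → ∈⊤)
  }
  where open _≅_ G≅H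

ΔOn-⊤ : ∀ {n} (H : Graph n) → ΔOn H ⊤ ≈ Δ H
ΔOn-⊤ H σ = mk⇔ proj₁ (λ Δσ → Δσ , λ {x} _ → ∈⊤ {x = x})

iso-collapsible : ∀ {m n} {G : Graph m} {H : Graph n} → CollapsibleGraph G → G ≅ H → CollapsibleGraph H
iso-collapsible {H = H} G↘ G≅H with Induced.induced-collapsible (iso-induced G≅H) G↘
... | w , H↘w = w , collapsesTo-respˡ (ΔOn-⊤ H) H↘w

-- (I2) Gluing a vertex.  The new vertex zero is a one-vertex clique with
-- common neighbourhood S (shifted), and deleting it leaves a copy of Δ(G).

module VertexGluing {n m} {G : Graph n} {H : Graph m} {S : Subset n} {G' : Graph (suc n)}
                    (H-on-S : InducedOn H G S) (glued : GluedVertex G S G') where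
  open GluedVertex glued

  apex : Subset (suc n)
  apex = ⁅ zero ⁆

  G-in-G' : InducedOn G G' (false ∷ ⊤)
  G-in-G' = record { emb = suc ; inj = λ _ _ → suc-injective ; preserve = old ; image = image }
    where
      image : ∀ v → (v ∈ false ∷ ⊤) ⇔ (∃ λ x → suc x ≡ v)
      image zero    = mk⇔ (λ ()) (λ { (_ , ()) })
      image (suc x) = mk⇔ (λ _ → x , refl) (λ _ → there ∈⊤)

  H-in-G' : InducedOn H G' (false ∷ S)
  H-in-G' = record
    { emb      = λ x → suc (emb x)
    ; inj      = λ x y eq → inj x y (suc-injective eq)
    ; preserve = λ x y → trans (old _ _) (preserve x y)
    ; image    = image'
    }
    where
      open InducedOn H-on-S
      image' : ∀ v → (v ∈ false ∷ S) ⇔ (∃ λ x → suc (emb x) ≡ v)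
      image' zero    = mk⇔ (λ ()) (λ { (_ , ()) })
      image' (suc u) = mk⇔ (λ { (there u∈S) → let (x , eq) = ⇒ (image u) u∈S in x , cong suc eq })
                           (λ { (x , eq) → there (⇐ (image u) (x , suc-injective eq)) })

  ∈-apex : ∀ {a} → a ∈ apex → a ≡ zero
  ∈-apex = x∈⁅y⁆⇒x≡y zero

  apex-nbhd : IsCommonNbhd G' apex (false ∷ S)
  apex-nbhd zero    = mk⇔ (λ ()) (λ (0∉apex , _) → ⊥-elim (0∉apex (x∈⁅x⁆ zero)))
  apex-nbhd (suc x) = mk⇔ into from
    where
      suc≢0 : suc x ≢ zero
      suc≢0 ()
      into : suc x ∈ false ∷ S → suc x ∉ apex × ∀ {a} → a ∈ apex → a ~[ G' ] suc x
      into (there x∈S) =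
        (λ x∈apex → suc≢0 (∈-apex x∈apex)) , λ a∈ → subst (_~[ G' ] suc x) (≡-sym (∈-apex a∈)) 0~x
        where
          0~x : zero ~[ G' ] suc x
          0~x = trans (new x) ([]=⇒lookup x∈S)
      from : suc x ∉ apex × (∀ {a} → a ∈ apex → a ~[ G' ] suc x) → suc x ∈ false ∷ S
      from (_ , adjacent) = there (lookup⇒[]= x S (trans (≡-sym (new x)) (adjacent (x∈⁅x⁆ zero))))

  apex-clique : Clique G' apex
  apex-clique x y x∈ y∈ x≢y = ⊥-elim (x≢y (trans (∈-apex x∈) (≡-sym (∈-apex y∈))))

  apex-deletion : ΔOn G' (false ∷ ⊤) ≈ Cone.deletion apex (Δ G')
  apex-deletion γ = mk⇔ (λ (Δγ , γ⊆old) → Δγ , λ apex⊆γ → old∌0 (γ⊆old (apex⊆γ (x∈⁅x⁆ zero))))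
                        (λ (Δγ , apex⊈γ) → Δγ , λ {x} x∈γ → in-old x x∈γ apex⊈γ)
    where
      old∌0 : zero ∉ false ∷ ⊤
      old∌0 ()
      in-old : ∀ x → x ∈ γ → ¬ (apex ⊆ γ) → x ∈ false ∷ ⊤
      in-old zero    0∈γ apex⊈γ = ⊥-elim (apex⊈γ (λ a∈ → subst (_∈ γ) (≡-sym (∈-apex a∈)) 0∈γ))
      in-old (suc x) _   _      = there ∈⊤

  glued-vertex-collapsible : CollapsibleGraph G → CollapsibleGraph H → CollapsibleGraph G'
  glued-vertex-collapsible G↘ H↘ with Induced.induced-collapsible G-in-G' G↘
  ... | w , old↘w =
    w , collapsesTo-trans (CliqueLink.clique-cone G' (zero , x∈⁅x⁆ zero) apex-clique apex-nbhd
                                                  (Induced.induced-collapsible H-in-G' H↘))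
                          (collapsesTo-respˡ apex-deletion old↘w)

-- (I4) Gluing an edge {v₁,v₂}.  Its two ends form a clique of G' whose common
-- neighbourhood is N(v₁,v₂), and the cliques of G' not containing both ends
-- are exactly the cliques of G.

module EdgeGluing {n m} {G G' : Graph n} {H : Graph m} {v₁ v₂ : Fin n} {S : Subset n}
                  (v₁≢v₂ : v₁ ≢ v₂) (v₁≁v₂ : ¬ (v₁ ~[ G ] v₂)) (S-nbhd : CommonNbhd G v₁ v₂ S)
                  (H-on-S : InducedOn H G S) (glued : GluedEdge G v₁ v₂ G') where

  ends : Subset n
  ends = ⁅ v₁ ⁆ ∪ ⁅ v₂ ⁆

  ∈-ends : ∀ {a} → a ∈ ends → a ≡ v₁ ⊎ a ≡ v₂
  ∈-ends {a} a∈ with x∈p∪q⁻ ⁅ v₁ ⁆ ⁅ v₂ ⁆ a∈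
  ... | inj₁ a∈₁ = inj₁ (x∈⁅y⁆⇒x≡y v₁ a∈₁)
  ... | inj₂ a∈₂ = inj₂ (x∈⁅y⁆⇒x≡y v₂ a∈₂)

  v₁∈ends : v₁ ∈ ends
  v₁∈ends = x∈p∪q⁺ (inj₁ (x∈⁅x⁆ v₁))

  v₂∈ends : v₂ ∈ ends
  v₂∈ends = x∈p∪q⁺ (inj₂ (x∈⁅x⁆ v₂))

  old-edge : ∀ {x y} → x ~[ G ] y → x ~[ G' ] y
  old-edge x~y = ⇐ (glued _ _) (inj₁ x~y)

  edge-cases : ∀ {x y} → x ~[ G' ] y → x ~[ G ] y ⊎ (x ∈ ends × y ∈ ends)
  edge-cases x~y with ⇒ (glued _ _) x~y
  ... | inj₁ old              = inj₁ old
  ... | inj₂ (inj₁ (refl , refl)) = inj₂ (v₁∈ends , v₂∈ends)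
  ... | inj₂ (inj₂ (refl , refl)) = inj₂ (v₂∈ends , v₁∈ends)

  edge-off-ends : ∀ {x y} → y ∉ ends → x ~[ G' ] y → x ~[ G ] y
  edge-off-ends y∉ x~y with edge-cases x~y
  ... | inj₁ old          = old
  ... | inj₂ (_ , y∈ends) = ⊥-elim (y∉ y∈ends)

  ends-covered : ∀ {x y γ} → x ∈ ends → y ∈ ends → x ≢ y → x ∈ γ → y ∈ γ → ends ⊆ γ
  ends-covered x∈ y∈ x≢y x∈γ y∈γ a∈ with ∈-ends x∈ | ∈-ends y∈ | ∈-ends a∈
  ... | inj₁ refl | inj₁ refl | _         = ⊥-elim (x≢y refl)
  ... | inj₂ refl | inj₂ refl | _         = ⊥-elim (x≢y refl)
  ... | inj₁ refl | inj₂ refl | inj₁ refl = x∈γ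
  ... | inj₁ refl | inj₂ refl | inj₂ refl = y∈γ
  ... | inj₂ refl | inj₁ refl | inj₁ refl = y∈γ
  ... | inj₂ refl | inj₁ refl | inj₂ refl = x∈γ

  S-off-ends : ∀ {u} → u ∈ S → u ∉ ends
  S-off-ends u∈S u∈ends with ⇒ (S-nbhd _) u∈S | ∈-ends u∈ends
  ... | v₁~u , _ | inj₁ refl = ~-irrefl G v₁~u
  ... | _ , v₂~u | inj₂ refl = ~-irrefl G v₂~u

  ends-clique : Clique G' ends
  ends-clique x y x∈ y∈ x≢y with ∈-ends x∈ | ∈-ends y∈
  ... | inj₁ refl | inj₁ refl = ⊥-elim (x≢y refl)
  ... | inj₁ refl | inj₂ refl = ⇐ (glued x y) (inj₂ (inj₁ (refl , refl)))
  ... | inj₂ refl | inj₁ refl = ⇐ (glued x y) (inj₂ (inj₂ (refl , refl)))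
  ... | inj₂ refl | inj₂ refl = ⊥-elim (x≢y refl)

  ends-nbhd : IsCommonNbhd G' ends S
  ends-nbhd u = mk⇔ into from
    where
      into : u ∈ S → u ∉ ends × ∀ {a} → a ∈ ends → a ~[ G' ] u
      into u∈S = S-off-ends u∈S , λ a∈ → old-edge (end-adjacent (∈-ends a∈))
        where
          end-adjacent : ∀ {a} → a ≡ v₁ ⊎ a ≡ v₂ → a ~[ G ] u
          end-adjacent (inj₁ refl) = proj₁ (⇒ (S-nbhd u) u∈S)
          end-adjacent (inj₂ refl) = proj₂ (⇒ (S-nbhd u) u∈S)
      from : u ∉ ends × (∀ {a} → a ∈ ends → a ~[ G' ] u) → u ∈ S
      from (u∉ , adjacent) =
        ⇐ (S-nbhd u) (edge-off-ends u∉ (adjacent v₁∈ends) , edge-off-ends u∉ (adjacent v₂∈ends))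

  -- on the common neighbourhood the adjacency of G' is that of G, so H is induced there too
  H-in-G' : InducedOn H G' S
  H-in-G' = record { emb = emb ; inj = inj ; image = image ; preserve = preserve' }
    where
      open InducedOn H-on-S
      preserve' : ∀ x y → adj G' (emb x) (emb y) ≡ adj H x y
      preserve' x y = trans (⇔→≡ (mk⇔ off-ends old-edge)) (preserve x y)
        where
          off-ends : emb x ~[ G' ] emb y → emb x ~[ G ] emb y
          off-ends x~y = ~-sym G (edge-off-ends (S-off-ends (⇐ (image _) (x , refl))) (~-sym G' x~y))

  ends-deletion : Δ G ≈ Cone.deletion ends (Δ G')
  ends-deletion γ = mk⇔ into from
    where
      into : Δ G γ → Cone.deletion ends (Δ G') γ
      into (γ≠∅ , clique) = (γ≠∅ , λ x y x∈ y∈ x≢y → old-edge (clique x y x∈ y∈ x≢y)) ,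
                            λ ends⊆γ → v₁≁v₂ (clique v₁ v₂ (ends⊆γ v₁∈ends) (ends⊆γ v₂∈ends) v₁≢v₂)
      from : Cone.deletion ends (Δ G') γ → Δ G γ
      from ((γ≠∅ , clique') , ends⊈γ) = γ≠∅ , clique
        where
          clique : Clique G γ
          clique x y x∈ y∈ x≢y with edge-cases (clique' x y x∈ y∈ x≢y)
          ... | inj₁ old = old
          ... | inj₂ (x∈ends , y∈ends) = ⊥-elim (ends⊈γ (ends-covered x∈ends y∈ends x≢y x∈ y∈))

  glued-edge-collapsible : CollapsibleGraph G → CollapsibleGraph H → CollapsibleGraph G'
  glued-edge-collapsible (w , G↘w) H↘ =
    w , collapsesTo-trans (CliqueLink.clique-cone G' (v₁ , v₁∈ends) ends-clique ends-nbhd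
                                                  (Induced.induced-collapsible H-in-G' H↘))
                          (collapsesTo-respˡ ends-deletion G↘w)

theorem3 : ∀ {n : ℕ} (G : Graph n) → StrongContractible G → CollapsibleGraph G
theorem3 G (K1 .G) = K1-collapsible G
theorem3 G (iso {G = G₀} G₀-contr G₀≅G) = iso-collapsible (theorem3 G₀ G₀-contr) G₀≅G
theorem3 G (I2 {G = G₀} {H = H₀} G₀-contr H₀-contr H₀-on-S glued) =
  VertexGluing.glued-vertex-collapsible H₀-on-S glued (theorem3 G₀ G₀-contr) (theorem3 H₀ H₀-contr)
theorem3 G (I4 {G = G₀} {H = H₀} G₀-contr v₁≢v₂ v₁≁v₂ S-nbhd H₀-contr H₀-on-S glued) =
  EdgeGluing.glued-edge-collapsible {G = G₀} {G} v₁≢v₂ v₁≁v₂ S-nbhd H₀-on-S glued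
                                    (theorem3 G₀ G₀-contr) (theorem3 H₀ H₀-contr)
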